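{- In the Kripke-style idempotent S4 system, if $(\Gamma,x:S);\Gamma'\vdash t:T$, then $\Gamma;(x:S,\Gamma')\vdash t:T$.
   Context: Types $T::=B\mid\square T\mid S\longrightarrow T$; terms $t::=x\mid\mathsf{box}\,t\mid\mathsf{unbox}\,t\mid\lambda x.t\mid s\ t$ (names, up to $\alpha$); contexts $\Gamma::=\cdot\mid\Gamma,x:T$, with $(\Gamma,\Gamma')$ denoting concatenation. The Kripke-style idempotent S4 system has judgments $\Gamma;\Gamma'\vdash t:T$ (two contexts: $\Gamma$ collects assumptions of all previous worlds, $\Gamma'$ of the current one), inductively defined by: if $x:T\in\Gamma'$ then $\Gamma;\Gamma'\vdash x:T$; if $(\Gamma,\Gamma');\cdot\vdash t:T$ then $\Gamma;\Gamma'\vdash\mathsf{box}\,t:\square T$; if $\cdot;(\Gamma,\Gamma')\vdash t:\square T$ then $\Gamma;\Gamma'\vdash\mathsf{unbox}\,t:T$; if $\Gamma;(\Gamma',x:S)\vdash t:T$ then $\Gamma;\Gamma'\vdash\lambda x.t:S\longrightarrow T$; if $\Gamma;\Gamma'\vdash t:S\longrightarrow T$ and $\Gamma;\Gamma'\vdash s:S$ then $\Gamma;\Gamma'\vdash t\ s:T$. -}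

module Defs where

open import Data.Nat using (ℕ)
open import Data.Product using (_×_; _,_)
open import Data.List using (List; []; _∷_; _++_; [_])
open import Data.List.Membership.Propositional using (_∈_)

-- Variable names (terms are named; α-equivalence is not needed for the
-- statement since typing is stated on raw named terms).
Name : Set
Name = ℕ

data Ty : Set where
  B    : Ty
  □_   : Ty → Ty
  _⟶_  : Ty → Ty → Ty

infixr 7 _⟶_
infix 8 □_

data Tm : Set where
  var   : Name → Tm
  box   : Tm → Tm
  unbox : Tm → Tm
  lam   : Name → Tm → Tm
  app   : Tm → Tm → Tm

-- Contexts: Γ ::= · | Γ , x : T   (a snoc-list, represented as a List
-- whose right end is the most recent entry; (Γ , Γ') is list append).
Ctx : Set
Ctx = List (Name × Ty)

_,,_∶_ : Ctx → Name → Ty → Ctx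
Γ ,, x ∶ S = Γ ++ [ (x , S) ]

infixl 5 _,,_∶_

data _⨾_⊢_∶_ : Ctx → Ctx → Tm → Ty → Set where
  ⊢var   : ∀ {Γ Γ' x T} → (x , T) ∈ Γ' → Γ ⨾ Γ' ⊢ var x ∶ T
  ⊢box   : ∀ {Γ Γ' t T} → (Γ ++ Γ') ⨾ [] ⊢ t ∶ T → Γ ⨾ Γ' ⊢ box t ∶ □ T
  ⊢unbox : ∀ {Γ Γ' t T} → [] ⨾ (Γ ++ Γ') ⊢ t ∶ □ T → Γ ⨾ Γ' ⊢ unbox t ∶ T
  ⊢lam   : ∀ {Γ Γ' x t S T} → Γ ⨾ (Γ' ,, x ∶ S) ⊢ t ∶ T → Γ ⨾ Γ' ⊢ lam x t ∶ S ⟶ T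
  ⊢app   : ∀ {Γ Γ' t s S T} → Γ ⨾ Γ' ⊢ t ∶ S ⟶ T → Γ ⨾ Γ' ⊢ s ∶ S → Γ ⨾ Γ' ⊢ app t s ∶ T

infix 4 _⨾_⊢_∶_

{-# OPTIONS --safe #-}
module Submission where

open import Defs
open import Data.Product using (_,_)
open import Data.List using (_∷_; _++_; [_])
open import Data.List.Properties using (++-assoc)
open import Data.List.Membership.Propositional.Properties using (∈-++⁺ʳ)
open import Relation.Binary.PropositionalEquality using (subst; sym)

-- Only variables consult the split; box and unbox see Γ ++ Γ', which is
-- unchanged up to associativity.
shift-to-local : ∀ {Γ Δ Γ' t T} → (Γ ++ Δ) ⨾ Γ' ⊢ t ∶ T → Γ ⨾ (Δ ++ Γ') ⊢ t ∶ T
shift-to-local {Δ = Δ} (⊢var x∈Γ') = ⊢var (∈-++⁺ʳ Δ x∈Γ')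
shift-to-local {Γ} {Δ} {Γ'} (⊢box d) =
  ⊢box (subst (λ Ψ → Ψ ⨾ _ ⊢ _ ∶ _) (++-assoc Γ Δ Γ') d)
shift-to-local {Γ} {Δ} {Γ'} (⊢unbox d) =
  ⊢unbox (subst (λ Ψ → _ ⨾ Ψ ⊢ _ ∶ _) (++-assoc Γ Δ Γ') d)
shift-to-local {Δ = Δ} {Γ'} (⊢lam {x = x} {S = S} d) =
  ⊢lam (subst (λ Ψ → _ ⨾ Ψ ⊢ _ ∶ _) (sym (++-assoc Δ Γ' [ (x , S) ]))
              (shift-to-local d))
shift-to-local (⊢app d e) = ⊢app (shift-to-local d) (shift-to-local e)

lemma4p1 : ∀ {Γ Γ' : Ctx} {x : Name} {S T : Ty} {t : Tm} →
    (Γ ,, x ∶ S) ⨾ Γ' ⊢ t ∶ T → Γ ⨾ ((x , S) ∷ Γ') ⊢ t ∶ T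
lemma4p1 = shift-to-local
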